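{- For every natural number $n \geq 3$, the sunlet graph $S_n$ satisfies $\gamma_b(S_n) = \left\lceil \frac{n+1}{2} \right\rceil$.
   Context: The sunlet graph $S_n$ is obtained from the cycle $C_n$ (vertices $v_1,\dots,v_n$, edges $v_iv_{i+1}$ and $v_nv_1$) by attaching to each cycle vertex $v_i$ one new vertex $w_i$ via a pendant edge $v_iw_i$. For a finite graph $G$ with shortest-path distance $d$, a dominating broadcast function is a function $f: V(G) \to \{0,1,2,\dots\}$ such that every vertex $u$ of $G$ satisfies $d(u,v) \leq f(v)$ for at least one vertex $v$ with $f(v) \geq 1$. The cost of $f$ is $\sum_{v \in V(G)} f(v)$, and $\gamma_b(G)$ is the minimum cost of a dominating broadcast function of $G$. -}

module Defs where

open import Data.Nat using (ℕ; zero; suc; _+_; _≤_)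
open import Data.Fin using (Fin; toℕ; splitAt)
open import Data.List using (tabulate)
open import Data.Nat.ListAction using (sum)
open import Data.Sum using (_⊎_; inj₁; inj₂)
open import Data.Product using (Σ; ∃; _×_; _,_)
open import Data.Unit using (⊤)
open import Data.Empty using (⊥)
open import Relation.Binary.PropositionalEquality using (_≡_)

record Graph (m : ℕ) : Set₁ where
  field
    Adj : Fin m → Fin m → Set

open Graph public

data Walk {m : ℕ} (G : Graph m) : Fin m → Fin m → ℕ → Set where
  here : ∀ {u} → Walk G u u zero
  step : ∀ {u w v k} → Adj G u w → Walk G w v k → Walk G u v (suc k)

-- d(u,v) ≤ r in the shortest-path distance: some u-v walk has length ≤ r.
DistLe : {m : ℕ} → Graph m → Fin m → Fin m → ℕ → Set
DistLe G u v r = Σ ℕ (λ k → k ≤ r × Walk G u v k)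

cost : {m : ℕ} → (Fin m → ℕ) → ℕ
cost f = sum (tabulate f)

IsDominatingBroadcast : {m : ℕ} → Graph m → (Fin m → ℕ) → Set
IsDominatingBroadcast G f = ∀ u → Σ _ (λ v → 1 ≤ f v × DistLe G u v (f v))

IsBroadcastDominationNumber : {m : ℕ} → Graph m → ℕ → Set
IsBroadcastDominationNumber G c =
  (Σ _ (λ f → IsDominatingBroadcast G f × cost f ≡ c))
  × (∀ f → IsDominatingBroadcast G f → c ≤ cost f)

-- Cycle C_n on Fin n: vertex i (0-based) is v_{i+1}; i ~ i+1 and (n-1) ~ 0.
CycSucc : (n : ℕ) → Fin n → Fin n → Set
CycSucc n a b = (suc (toℕ a) ≡ toℕ b) ⊎ (suc (toℕ a) ≡ n × toℕ b ≡ 0)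

CycAdj : (n : ℕ) → Fin n → Fin n → Set
CycAdj n a b = CycSucc n a b ⊎ CycSucc n b a

-- Sunlet S_n on Fin (n + n): the first n vertices are the cycle vertices v_i,
-- the last n vertices are the pendant vertices w_i, with w_i adjacent only to v_i.
SunletAdj : (n : ℕ) → Fin (n + n) → Fin (n + n) → Set
SunletAdj n x y with splitAt n x | splitAt n y
... | inj₁ a | inj₁ b = CycAdj n a b
... | inj₁ a | inj₂ b = a ≡ b
... | inj₂ a | inj₁ b = a ≡ b
... | inj₂ a | inj₂ b = ⊥

Sunlet : (n : ℕ) → Graph (n + n)
Sunlet n = record { Adj = SunletAdj n }

-- Lower bound: a pendant vertex w_j can only hear a broadcaster v of power s ≥ 1 through
-- v_j, so j lies within cycle distance s − 1 of the position of v.  Hence v covers at most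
-- 2s − 1 pendants, and covering all n of them forces n ≤ Σ_v (2 f v − 1) ≤ 2 cost f − 1.
-- Upper bound: one broadcast of power ⌈(n+1)/2⌉ from v₁ reaches every cycle vertex within
-- ⌊n/2⌋ steps, and every pendant one step later.
module Submission where

open import Defs
open import Data.Nat using (ℕ; zero; suc; _+_; _∸_; _≤_; _<_; _≤′_; ≤′-refl; ≤′-step; z≤n; s≤s; ⌈_/2⌉)
open import Data.Nat.Properties
open import Data.Fin as Fin using (Fin; toℕ; fromℕ; fromℕ<; inject₁; lower₁; splitAt; join; _↑ˡ_; _↑ʳ_)
open import Data.Fin.Properties using (toℕ-injective; toℕ<n; toℕ-fromℕ; toℕ-fromℕ<; toℕ-inject₁; toℕ-inject₁-≢; inject₁-lower₁; lower₁-inject₁′; splitAt-↑ˡ; splitAt-↑ʳ; join-splitAt)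
open import Data.Sum using (_⊎_; inj₁; inj₂; [_,_]′)
open import Function using (id; _∘_)
open import Data.List using (List; []; _∷_; map; tabulate; length)
open import Data.List.Properties using (map-tabulate; length-tabulate)
import Data.List.Relation.Unary.Any.Properties as Any
open Any using (tabulate⁺)
open import Data.List.Relation.Unary.Any using (Any; here; there)
open import Data.Nat.ListAction using (sum)
open import Data.Nat.Tactic.RingSolver using (solve-∀)
open import Data.Fin.Subset using (Subset; inside; outside; _∈_; _∪_; ⋃; ⁅_⁆; ∣_∣; ⊥; ⊤)
open import Data.Fin.Subset.Properties using (∣p∣≤∣x∷p∣; ∣⊥∣≡0; ∣⊤∣≡n; ∣⁅x⁆∣≡1; x∈⁅x⁆; x∈p∪q⁺; p⊆q⇒∣p∣≤∣q∣)
open import Data.Vec using (_∷_; [])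
open import Algebra.Properties.CommutativeSemigroup +-commutativeSemigroup using (interchange)
open import Data.Product using (Σ; _×_; _,_)
open import Relation.Nullary using (yes; no; contradiction)
open import Relation.Binary.PropositionalEquality

∣p∪q∣≤∣p∣+∣q∣ : ∀ {n} (p q : Subset n) → ∣ p ∪ q ∣ ≤ ∣ p ∣ + ∣ q ∣
∣p∪q∣≤∣p∣+∣q∣ []            []            = z≤n
∣p∪q∣≤∣p∣+∣q∣ (inside  ∷ p) (y ∷ q)       =
  s≤s (≤-trans (∣p∪q∣≤∣p∣+∣q∣ p q) (+-monoʳ-≤ ∣ p ∣ (∣p∣≤∣x∷p∣ y q)))
∣p∪q∣≤∣p∣+∣q∣ (outside ∷ p) (outside ∷ q) = ∣p∪q∣≤∣p∣+∣q∣ p q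
∣p∪q∣≤∣p∣+∣q∣ (outside ∷ p) (inside  ∷ q) =
  ≤-trans (s≤s (∣p∪q∣≤∣p∣+∣q∣ p q)) (≤-reflexive (sym (+-suc ∣ p ∣ ∣ q ∣)))

∣⋃ps∣≤sum : ∀ {n} (ps : List (Subset n)) → ∣ ⋃ ps ∣ ≤ sum (map ∣_∣ ps)
∣⋃ps∣≤sum {n} []       = ≤-reflexive (∣⊥∣≡0 n)
∣⋃ps∣≤sum (p ∷ ps)     = ≤-trans (∣p∪q∣≤∣p∣+∣q∣ p (⋃ ps)) (+-monoʳ-≤ ∣ p ∣ (∣⋃ps∣≤sum ps))

∣⋃⁅xs⁆∣≤length : ∀ {n} (xs : List (Fin n)) → ∣ ⋃ (map ⁅_⁆ xs) ∣ ≤ length xs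
∣⋃⁅xs⁆∣≤length {n} []       = ≤-reflexive (∣⊥∣≡0 n)
∣⋃⁅xs⁆∣≤length (x ∷ xs)     =
  ≤-trans (∣p∪q∣≤∣p∣+∣q∣ ⁅ x ⁆ _) (+-mono-≤ (≤-reflexive (∣⁅x⁆∣≡1 x)) (∣⋃⁅xs⁆∣≤length xs))

x∈⋃⁺ : ∀ {n} {x : Fin n} {ps} → Any (x ∈_) ps → x ∈ ⋃ ps
x∈⋃⁺ (here x∈p)   = x∈p∪q⁺ (inj₁ x∈p)
x∈⋃⁺ (there x∈ps) = x∈p∪q⁺ (inj₂ (x∈⋃⁺ x∈ps))

sum-tabulate-mono : ∀ {k} {f g : Fin k → ℕ} → (∀ i → f i ≤ g i) → sum (tabulate f) ≤ sum (tabulate g)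
sum-tabulate-mono {zero}  f≤g = z≤n
sum-tabulate-mono {suc k} f≤g = +-mono-≤ (f≤g Fin.zero) (sum-tabulate-mono (f≤g ∘ Fin.suc))

sum-tabulate-zero : ∀ k → sum (tabulate {n = k} λ _ → 0) ≡ 0
sum-tabulate-zero zero    = refl
sum-tabulate-zero (suc k) = sum-tabulate-zero k

arcLength : ℕ → ℕ
arcLength zero    = 0
arcLength (suc e) = suc (e + e)

sum-arcLength≤ : ∀ xs → sum (map arcLength xs) ≤ sum xs + sum xs
sum-arcLength≤ []       = z≤n
sum-arcLength≤ (x ∷ xs) = begin
  arcLength x + sum (map arcLength xs) ≤⟨ +-mono-≤ (arcLength≤ x) (sum-arcLength≤ xs) ⟩
  x + x + (sum xs + sum xs)             ≡⟨ interchange x x (sum xs) (sum xs) ⟩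
  x + sum xs + (x + sum xs)             ∎
  where
  open ≤-Reasoning
  arcLength≤ : ∀ s → arcLength s ≤ s + s
  arcLength≤ zero    = z≤n
  arcLength≤ (suc e) = s≤s (+-monoʳ-≤ e (n≤1+n e))

sum-arcLength< : ∀ xs → 0 < sum (map arcLength xs) → sum (map arcLength xs) < sum xs + sum xs
sum-arcLength< (zero  ∷ xs) pos = sum-arcLength< xs pos
sum-arcLength< (suc e ∷ xs) _   = begin-strict
  suc (e + e) + sum (map arcLength xs) <⟨ s≤s (s≤s (+-monoʳ-≤ (e + e) (sum-arcLength≤ xs))) ⟩
  suc (suc (e + e + (sum xs + sum xs))) ≡⟨ regroup e (sum xs) ⟩
  suc e + sum xs + (suc e + sum xs)     ∎
  where
  open ≤-Reasoning
  regroup : ∀ a b → suc (suc (a + a + (b + b))) ≡ suc a + b + (suc a + b)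
  regroup = solve-∀

≤-double-suc : ∀ e {t} → t ≤ e + e → suc t ≤ suc e + suc e
≤-double-suc e t≤2e = s≤s (≤-trans t≤2e (+-monoʳ-≤ e (n≤1+n e)))

module _ {m : ℕ} where

  next : Fin (suc m) → Fin (suc m)
  next i with m ≟ toℕ i
  ... | yes _  = Fin.zero
  ... | no m≢i = Fin.suc (lower₁ i m≢i)

  prev : Fin (suc m) → Fin (suc m)
  prev Fin.zero    = fromℕ m
  prev (Fin.suc i) = inject₁ i

  prev-next : ∀ i → prev (next i) ≡ i
  prev-next i with m ≟ toℕ i
  ... | yes m≡i = toℕ-injective (trans (toℕ-fromℕ m) m≡i)
  ... | no m≢i  = inject₁-lower₁ i m≢i

  next-prev : ∀ i → next (prev i) ≡ i
  next-prev Fin.zero with m ≟ toℕ (fromℕ m)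
  ... | yes _  = refl
  ... | no m≢m = contradiction (sym (toℕ-fromℕ m)) m≢m
  next-prev (Fin.suc i) with m ≟ toℕ (inject₁ i)
  ... | yes m≡i = contradiction m≡i (toℕ-inject₁-≢ i)
  ... | no m≢i  = cong Fin.suc (lower₁-inject₁′ i m≢i)

  next-injective : ∀ {i j} → next i ≡ next j → i ≡ j
  next-injective {i} {j} eq = begin
    i              ≡⟨ sym (prev-next i) ⟩
    prev (next i)  ≡⟨ cong prev eq ⟩
    prev (next j)  ≡⟨ prev-next j ⟩
    j              ∎
    where open ≡-Reasoning

  CycSucc⇒prev≡ : ∀ {a b} → CycSucc (suc m) a b → prev b ≡ a
  CycSucc⇒prev≡ {a} {Fin.zero}  (inj₂ (a+1≡n , _)) =
    toℕ-injective (trans (toℕ-fromℕ m) (sym (suc-injective a+1≡n)))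
  CycSucc⇒prev≡ {a} {Fin.suc j} (inj₁ a+1≡j+1) =
    toℕ-injective (trans (toℕ-inject₁ j) (sym (suc-injective a+1≡j+1)))

  CycSucc⇒≡next : ∀ {a b} → CycSucc (suc m) a b → b ≡ next a
  CycSucc⇒≡next {a} {b} ab = trans (sym (next-prev b)) (cong next (CycSucc⇒prev≡ ab))

  nextⁿ : ℕ → Fin (suc m) → Fin (suc m)
  nextⁿ zero    i = i
  nextⁿ (suc t) i = nextⁿ t (next i)

  prevⁿ : ℕ → Fin (suc m) → Fin (suc m)
  prevⁿ zero    i = i
  prevⁿ (suc e) i = prev (prevⁿ e i)

  nextⁿ-suc : ∀ t i → nextⁿ (suc t) i ≡ next (nextⁿ t i)
  nextⁿ-suc zero    i = refl
  nextⁿ-suc (suc t) i = nextⁿ-suc t (next i)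

  Near : Fin (suc m) → Fin (suc m) → Set
  Near u w = u ≡ w ⊎ w ≡ next u ⊎ u ≡ next w

  -- j is among the 2e + 1 consecutive positions centred at i.
  Arc : Fin (suc m) → ℕ → Fin (suc m) → Set
  Arc i e j = Σ ℕ λ t → t ≤ e + e × nextⁿ t (prevⁿ e i) ≡ j

  Arc-centre : ∀ i → Arc i 0 i
  Arc-centre i = 0 , z≤n , refl

  Arc-step : ∀ {i e u w} → Near u w → Arc i e w → Arc i (suc e) u
  Arc-step {e = e} (inj₁ refl) (t , t≤2e , eq) =
    suc t , ≤-double-suc e t≤2e , trans (cong (nextⁿ t) (next-prev _)) eq
  Arc-step {u = u} (inj₂ (inj₁ w≡u+1)) (zero , _ , eq) =
    zero , z≤n , trans (cong prev (trans eq w≡u+1)) (prev-next u)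
  Arc-step {e = e} (inj₂ (inj₁ w≡u+1)) (suc t , t<2e , eq) =
    suc t , ≤-double-suc e (<⇒≤ t<2e) ,
    trans (cong (nextⁿ t) (next-prev _))
      (sym (next-injective (trans (sym w≡u+1) (trans (sym eq) (nextⁿ-suc t _)))))
  Arc-step {e = e} (inj₂ (inj₂ u≡w+1)) (t , t≤2e , eq) =
    suc (suc t) , s≤s (subst (suc t ≤_) (sym (+-suc e e)) (s≤s t≤2e)) ,
    trans (cong (nextⁿ (suc t)) (next-prev _))
      (trans (nextⁿ-suc t _) (trans (cong next eq) (sym u≡w+1)))

  Arc-mono : ∀ {i e e′ j} → e ≤′ e′ → Arc i e j → Arc i e′ j
  Arc-mono ≤′-refl       a = a
  Arc-mono (≤′-step e≤e′) a = Arc-step (inj₁ refl) (Arc-mono e≤e′ a)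

position : ∀ {n} → Fin (n + n) → Fin n
position {n} x = [ id , id ]′ (splitAt n x)

pendant : ∀ {n} → Fin n → Fin (n + n)
pendant {n} j = n ↑ʳ j

position-pendant : ∀ {n} (j : Fin n) → position (pendant j) ≡ j
position-pendant {n} j = cong [ id , id ]′ (splitAt-↑ʳ n n j)

module _ {m : ℕ} where

  private
    n = suc m

  SunletAdj⇒Near : ∀ x y → SunletAdj n x y → Near (position x) (position y)
  SunletAdj⇒Near x y xy with splitAt n x | splitAt n y
  ... | inj₁ a | inj₁ b = cycle xy
    where
    cycle : CycAdj n a b → Near a b
    cycle (inj₁ ab) = inj₂ (inj₁ (CycSucc⇒≡next ab))
    cycle (inj₂ ba) = inj₂ (inj₂ (CycSucc⇒≡next ba))
  ... | inj₁ _ | inj₂ _ = inj₁ xy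
  ... | inj₂ _ | inj₁ _ = inj₁ xy

  Walk⇒Arc : ∀ {u x k} → Walk (Sunlet n) u x k → Arc (position x) k (position u)
  Walk⇒Arc here                 = Arc-centre _
  Walk⇒Arc (step {u} {w} uw wx) = Arc-step (SunletAdj⇒Near u w uw) (Walk⇒Arc wx)

  pendant-neighbour : ∀ {j} w → SunletAdj n (pendant j) w → position w ≡ j
  pendant-neighbour {j} w = go (splitAt-↑ʳ n n j)
    where
    go : ∀ {x} → splitAt n x ≡ inj₂ j → SunletAdj n x w → position w ≡ j
    go {x} eq adj with splitAt n x | splitAt n w
    go refl adj | inj₂ _ | inj₁ _ = sym adj

  Walk-pendant⇒Arc : ∀ {j x k e} → Walk (Sunlet n) (pendant j) x k → k ≤ suc e →
                     Arc (position x) e j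
  Walk-pendant⇒Arc {j} {e = e} here _ =
    subst (λ i → Arc i e j) (sym (position-pendant j))
      (Arc-mono {e′ = e} (≤⇒≤′ z≤n) (Arc-centre j))
  Walk-pendant⇒Arc {x = x} {e = e} (step {w = w} jw wx) (s≤s k≤e) =
    subst (Arc (position x) e) (pendant-neighbour w jw) (Arc-mono (≤⇒≤′ k≤e) (Walk⇒Arc wx))

  arcPosition : Fin n → (e : ℕ) → Fin (suc (e + e)) → Fin n
  arcPosition i e t = nextⁿ (toℕ t) (prevⁿ e i)

  arc : Fin n → ℕ → Subset n
  arc i e = ⋃ (map ⁅_⁆ (tabulate (arcPosition i e)))

  Arc⇒∈arc : ∀ {i e j} → Arc i e j → j ∈ arc i e
  Arc⇒∈arc {i} {e} {j} (t , t≤2e , eq) =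
    x∈⋃⁺ (Any.map⁺ {f = ⁅_⁆}
      (tabulate⁺ {f = arcPosition i e} t′ (subst (λ y → j ∈ ⁅ y ⁆) j≡t′ (x∈⁅x⁆ j))))
    where
    t′ = fromℕ< (s≤s t≤2e)
    j≡t′ : j ≡ arcPosition i e t′
    j≡t′ = trans (sym eq) (cong (λ k → nextⁿ k (prevⁿ e i)) (sym (toℕ-fromℕ< (s≤s t≤2e))))

  -- Contains every j such that w_j hears a broadcast of power s from a vertex at position i.
  covered : ℕ → Fin n → Subset n
  covered zero    _ = ⊥
  covered (suc e) i = arc i e

  ∣covered∣≤arcLength : ∀ s i → ∣ covered s i ∣ ≤ arcLength s
  ∣covered∣≤arcLength zero    _ = ≤-reflexive (∣⊥∣≡0 n)
  ∣covered∣≤arcLength (suc e) i =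
    ≤-trans (∣⋃⁅xs⁆∣≤length (tabulate (arcPosition i e))) (≤-reflexive (length-tabulate (arcPosition i e)))

  pendant∈covered : ∀ {j v s k} → 1 ≤ s → k ≤ s → Walk (Sunlet n) (pendant j) v k →
                    j ∈ covered s (position v)
  pendant∈covered {s = suc e} (s≤s _) k≤s walk = Arc⇒∈arc {e = e} (Walk-pendant⇒Arc walk k≤s)

  cost-lower-bound : ∀ f → IsDominatingBroadcast (Sunlet n) f → n + 1 ≤ cost f + cost f
  cost-lower-bound f dominating =
    subst (_≤ cost f + cost f) (+-comm 1 n)
      (≤-<-trans n≤ (sum-arcLength< (tabulate f) (≤-trans (s≤s z≤n) n≤)))
    where
    C : Fin (n + n) → Subset n
    C v = covered (f v) (position v)

    every-pendant-covered : ∀ j → j ∈ ⋃ (tabulate C)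
    every-pendant-covered j with dominating (pendant j)
    ... | v , 1≤fv , k , k≤fv , walk = x∈⋃⁺ (tabulate⁺ {f = C} v (pendant∈covered 1≤fv k≤fv walk))

    n≤ : n ≤ sum (map arcLength (tabulate f))
    n≤ = begin
      n                                ≡⟨ sym (∣⊤∣≡n n) ⟩
      ∣ ⊤ {n} ∣                        ≤⟨ p⊆q⇒∣p∣≤∣q∣ {p = ⊤} (λ {j} _ → every-pendant-covered j) ⟩
      ∣ ⋃ (tabulate C) ∣               ≤⟨ ∣⋃ps∣≤sum (tabulate C) ⟩
      sum (map ∣_∣ (tabulate C))       ≡⟨ cong sum (map-tabulate C ∣_∣) ⟩
      sum (tabulate (∣_∣ ∘ C))         ≤⟨ sum-tabulate-mono {f = ∣_∣ ∘ C} {g = arcLength ∘ f}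
                                            (λ v → ∣covered∣≤arcLength (f v) (position v)) ⟩
      sum (tabulate (arcLength ∘ f))   ≡⟨ cong sum (sym (map-tabulate f arcLength)) ⟩
      sum (map arcLength (tabulate f)) ∎
      where open ≤-Reasoning

  vertex : Fin n → Fin (n + n)
  vertex a = a ↑ˡ n

  cycle-edge : ∀ {a b} → CycAdj n a b → SunletAdj n (vertex a) (vertex b)
  cycle-edge {a} {b} ab rewrite splitAt-↑ˡ n a n | splitAt-↑ˡ n b n = ab

  pendant-edge : ∀ a → SunletAdj n (pendant a) (vertex a)
  pendant-edge a rewrite splitAt-↑ʳ n n a | splitAt-↑ˡ n a n = refl

  descend : ∀ k {a} → toℕ a ≡ k → Walk (Sunlet n) (vertex a) (vertex Fin.zero) k
  descend zero    {Fin.zero} _     = here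
  descend (suc k) {a}        a≡1+k =
    step (cycle-edge (inj₂ (inj₁ (trans (cong suc (toℕ-fromℕ< k<n)) (sym a≡1+k)))))
         (descend k (toℕ-fromℕ< k<n))
    where
    k<n : k < n
    k<n = <⇒≤ (subst (_< n) a≡1+k (toℕ<n a))

  ascend : ∀ k {a} → toℕ a + k ≡ n → Walk (Sunlet n) (vertex a) (vertex Fin.zero) k
  ascend zero          {a} a≡n   = contradiction (trans (sym (+-identityʳ (toℕ a))) a≡n) (<⇒≢ (toℕ<n a))
  ascend (suc zero)    {a} a+1≡n =
    step (cycle-edge (inj₁ (inj₂ (trans (+-comm 1 (toℕ a)) a+1≡n , refl)))) here
  ascend (suc (suc k)) {a} a+k≡n =
    step (cycle-edge (inj₁ (inj₁ (sym (toℕ-fromℕ< a+1<n)))))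
         (ascend (suc k) (trans (cong (_+ suc k) (toℕ-fromℕ< a+1<n))
                                (trans (sym (+-suc (toℕ a) (suc k))) a+k≡n)))
    where
    a+1<n : suc (toℕ a) < n
    a+1<n = subst (2 + toℕ a ≤_) a+k≡n
              (≤-trans (≤-reflexive (+-comm 2 (toℕ a))) (+-monoʳ-≤ (toℕ a) (m≤m+n 2 k)))

  cycle-walk-to-root : ∀ {s} → n + 1 ≤ s + s → ∀ a →
                       Σ ℕ λ k → k < s × Walk (Sunlet n) (vertex a) (vertex Fin.zero) k
  cycle-walk-to-root {s} n+1≤2s a with toℕ a <? s
  ... | yes a<s = toℕ a , a<s , descend (toℕ a) refl
  ... | no a≮s  = n ∸ toℕ a , n∸a<s , ascend (n ∸ toℕ a) (m+[n∸m]≡n (<⇒≤ (toℕ<n a)))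
    where
    n∸a<s : n ∸ toℕ a < s
    n∸a<s = +-cancelʳ-≤ (toℕ a) (suc (n ∸ toℕ a)) s (begin
      suc (n ∸ toℕ a + toℕ a) ≡⟨ cong suc (m∸n+n≡m (<⇒≤ (toℕ<n a))) ⟩
      suc n                   ≡⟨ +-comm 1 n ⟩
      n + 1                   ≤⟨ n+1≤2s ⟩
      s + s                   ≤⟨ +-monoʳ-≤ s (≮⇒≥ a≮s) ⟩
      s + toℕ a               ∎)
      where open ≤-Reasoning

  rootBroadcast : ℕ → Fin (n + n) → ℕ
  rootBroadcast s Fin.zero    = s
  rootBroadcast s (Fin.suc _) = 0

  cost-rootBroadcast : ∀ s → cost (rootBroadcast s) ≡ s
  cost-rootBroadcast s = trans (cong (s +_) (sum-tabulate-zero (m + n))) (+-identityʳ s)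

  rootBroadcast-dominating : ∀ {s} → n + 1 ≤ s + s → IsDominatingBroadcast (Sunlet n) (rootBroadcast s)
  rootBroadcast-dominating {s} n+1≤2s u =
    Fin.zero , positive n+1≤2s ,
    subst (λ u → DistLe (Sunlet n) u Fin.zero s) (join-splitAt n n u) (distance (splitAt n u))
    where
    positive : ∀ {s} → n + 1 ≤ s + s → 1 ≤ s
    positive {suc _} _ = s≤s z≤n

    distance : ∀ x → DistLe (Sunlet n) (join n n x) Fin.zero s
    distance (inj₁ a) with cycle-walk-to-root n+1≤2s a
    ... | k , k<s , walk = k , <⇒≤ k<s , walk
    distance (inj₂ a) with cycle-walk-to-root n+1≤2s a
    ... | k , k<s , walk = suc k , k<s , step (pendant-edge a) walk

theorem2 : (n : ℕ) → 3 ≤ n → IsBroadcastDominationNumber (Sunlet n) ⌈ n + 1 /2⌉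
theorem2 (suc m) _ =
  (rootBroadcast s , rootBroadcast-dominating n+1≤2s , cost-rootBroadcast {m} s) ,
  λ f dominating →
    subst (s ≤_) (sym (n≡⌈n+n/2⌉ (cost f))) (⌈n/2⌉-mono (cost-lower-bound f dominating))
  where
  s = ⌈ suc m + 1 /2⌉
  n+1≤2s : suc m + 1 ≤ s + s
  n+1≤2s = ≤-trans (≤-reflexive (sym (⌊n/2⌋+⌈n/2⌉≡n (suc m + 1))))
                   (+-monoˡ-≤ s (⌊n/2⌋≤⌈n/2⌉ (suc m + 1)))
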